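{- Let $r,r'$ be rigid expressions and $\vec b,\vec b'$ rigid monomials. If $r\asymp r'$ and $r[\vec b/x]\cong r'[\vec b'/x]$, then $r\cong r'$ and $\vec b\cong\vec b'$.
   Context: Rigid terms and monomials: $a,b,c ::= x\mid\lambda x.a\mid\langle a\rangle\vec b\mid a\oplus\bullet\mid\bullet\oplus a$, $\vec b::=(b_1,\dots,b_n)$ (finite lists; $|\vec b|=n$, $::$ concatenation), up to $\alpha$-equivalence; $n_x(r)$ counts free occurrences of $x$. Rigid substitution, for $|\vec b|=n_x(r)$: $x[(b)/x]=b$, $y[()/x]=y$ ($y\ne x$), $(\lambda z.a)[\vec b/x]=\lambda z.a[\vec b/x]$ ($z$ fresh), $(a\oplus\bullet)[\vec b/x]=a[\vec b/x]\oplus\bullet$, $(\bullet\oplus a)[\vec b/x]=\bullet\oplus a[\vec b/x]$, $(\langle c\rangle\vec d)[\vec b_0::\vec b_1/x]=\langle c[\vec b_0/x]\rangle\vec d[\vec b_1/x]$ with $|\vec b_0|=n_x(c)$, $|\vec b_1|=n_x(\vec d)$, $(a_1,\dots,a_n)[\vec b_1::\cdots::\vec b_n/x]=(a_1[\vec b_1/x],\dots,a_n[\vec b_n/x])$ with $|\vec b_i|=n_x(a_i)$; if $|\vec b|\ne n_x(r)$, $r[\vec b/x]$ is a formal element $0$. The relation $r\cong r'$ holds between rigid expressions (never $0$) iff they become equal after replacing recursively every list by the multiset of its elements; equivalently it is generated by: $x\cong x$; $\lambda x.a\cong\lambda x.a'$, $a\oplus\bullet\cong a'\oplus\bullet$,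 $\bullet\oplus a\cong\bullet\oplus a'$ if $a\cong a'$; $\langle c\rangle\vec d\cong\langle c'\rangle\vec d'$ if $c\cong c'$ and $\vec d\cong\vec d'$; $(a_1,\dots,a_n)\cong(a'_1,\dots,a'_n)$ if there is $\sigma\in\mathfrak S_n$ with $a_i\cong a'_{\sigma(i)}$ for all $i$. Rigid coherence $\asymp$: $x\asymp x$; $\lambda x.a\asymp\lambda x.a'$ if $a\asymp a'$; $\langle c\rangle\vec d\asymp\langle c'\rangle\vec d'$ if $c\asymp c'$ and $\vec d\asymp\vec d'$; $(b_1,\dots,b_n)\asymp(b_{n+1},\dots,b_{n+m})$ if $b_i\asymp b_j$ for all $1\le i,j\le n+m$; $a\oplus\bullet\asymp a'\oplus\bullet$ and $\bullet\oplus a\asymp\bullet\oplus a'$ if $a\asymp a'$; $a\oplus\bullet\asymp\bullet\oplus a'$ for all $a,a'$ (symmetric). -}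

module Defs where

open import Data.Nat using (ℕ; zero; suc; _<ᵇ_; _≡ᵇ_; _+_)
open import Data.Bool using (Bool; true; false; if_then_else_)
open import Data.List using (List; []; _∷_; length; take; drop; map; _++_; lookup)
open import Data.Maybe using (Maybe; just; nothing)
open import Data.Fin using (Fin)
open import Data.Fin.Permutation using (Permutation; _⟨$⟩ʳ_)

-- Rigid terms (de Bruijn indices, so terms are taken up to α-equivalence)
--   var i          : variable
--   lam a          : λ-abstraction (binds index 0)
--   app c ds       : ⟨c⟩ d⃗   (d⃗ a rigid monomial = finite list of terms)
--   inl a          : a ⊕ •
--   inr a          : • ⊕ a
-- Rigid monomials are  List Term.

data Term : Set where
  var : ℕ → Term
  lam : Term → Term
  app : Term → List Term → Term
  inl : Term → Term
  inr : Term → Term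

Monomial : Set
Monomial = List Term

data Sort : Set where
  tm mon : Sort

Expr : Sort → Set
Expr tm  = Term
Expr mon = Monomial

mutual
  shift : ℕ → Term → Term
  shift c (var i) = if i <ᵇ c then var i else var (suc i)
  shift c (lam a) = lam (shift (suc c) a)
  shift c (app a ds) = app (shift c a) (shifts c ds)
  shift c (inl a) = inl (shift c a)
  shift c (inr a) = inr (shift c a)

  shifts : ℕ → List Term → List Term
  shifts c [] = []
  shifts c (a ∷ as) = shift c a ∷ shifts c as

mutual
  occ : ℕ → Term → ℕ
  occ k (var i) = if i ≡ᵇ k then 1 else 0
  occ k (lam a) = occ (suc k) a
  occ k (app a ds) = occ k a + occs k ds
  occ k (inl a) = occ k a
  occ k (inr a) = occ k a

  occs : ℕ → List Term → ℕ
  occs k [] = 0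
  occs k (a ∷ as) = occ k a + occs k as

-- Rigid substitution r[b⃗/x] (x = index k).  'nothing' is the formal 0,
-- obtained exactly when |b⃗| ≠ n_x(r).  Indices other than k are left
-- unchanged (x is a name; it may occur in b⃗).

private
  _>>=_ : {A B : Set} → Maybe A → (A → Maybe B) → Maybe B
  just a  >>= f = f a
  nothing >>= f = nothing

mutual
  subst : ℕ → Term → List Term → Maybe Term
  subst k (var i) bs with i ≡ᵇ k
  subst k (var i) (b ∷ []) | true  = just b
  subst k (var i) _        | true  = nothing
  subst k (var i) []       | false = just (var i)
  subst k (var i) (_ ∷ _)  | false = nothing
  subst k (lam a) bs = subst (suc k) a (shifts 0 bs) >>= λ a' → just (lam a')
  subst k (app a ds) bs =
    subst k a (take (occ k a) bs) >>= λ a' →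
    substs k ds (drop (occ k a) bs) >>= λ ds' →
    just (app a' ds')
  subst k (inl a) bs = subst k a bs >>= λ a' → just (inl a')
  subst k (inr a) bs = subst k a bs >>= λ a' → just (inr a')

  substs : ℕ → List Term → List Term → Maybe (List Term)
  substs k [] [] = just []
  substs k [] (_ ∷ _) = nothing
  substs k (a ∷ as) bs =
    subst k a (take (occ k a) bs) >>= λ a' →
    substs k as (drop (occ k a) bs) >>= λ as' →
    just (a' ∷ as')

substE : (s : Sort) → ℕ → Expr s → List Term → Maybe (Expr s)
substE tm  k r bs = subst k r bs
substE mon k r bs = substs k r bs

mutual
  data _≅_ : Term → Term → Set where
    var≅ : ∀ {i} → var i ≅ var i
    lam≅ : ∀ {a a'} → a ≅ a' → lam a ≅ lam a'
    app≅ : ∀ {c c' ds ds'} → c ≅ c' → ds ≅ˡ ds' → app c ds ≅ app c' ds'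
    inl≅ : ∀ {a a'} → a ≅ a' → inl a ≅ inl a'
    inr≅ : ∀ {a a'} → a ≅ a' → inr a ≅ inr a'

  data _≅ˡ_ : List Term → List Term → Set where
    perm≅ : ∀ {as as'} (σ : Permutation (length as) (length as')) →
            (∀ i → lookup as i ≅ lookup as' (σ ⟨$⟩ʳ i)) → as ≅ˡ as'

_≅E_ : {s : Sort} → Expr s → Expr s → Set
_≅E_ {tm}  = _≅_
_≅E_ {mon} = _≅ˡ_

-- ≅ lifted to possibly-zero results: 0 is never related to anything.
data _≅?_ {s : Sort} : Maybe (Expr s) → Maybe (Expr s) → Set where
  just≅ : ∀ {r r'} → r ≅E r' → just r ≅? just r'

mutual
  data _≍_ : Term → Term → Set where
    var≍ : ∀ {i} → var i ≍ var i
    lam≍ : ∀ {a a'} → a ≍ a' → lam a ≍ lam a'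
    app≍ : ∀ {c c' ds ds'} → c ≍ c' → ds ≍ˡ ds' → app c ds ≍ app c' ds'
    inl≍ : ∀ {a a'} → a ≍ a' → inl a ≍ inl a'
    inr≍ : ∀ {a a'} → a ≍ a' → inr a ≍ inr a'
    inlr≍ : ∀ {a a'} → inl a ≍ inr a'
    inrl≍ : ∀ {a a'} → inr a ≍ inl a'

  data _≍ˡ_ : List Term → List Term → Set where
    coh≍ : ∀ {as as'} →
           (∀ i j → lookup (as ++ as') i ≍ lookup (as ++ as') j) → as ≍ˡ as'

_≍E_ : {s : Sort} → Expr s → Expr s → Set
_≍E_ {tm}  = _≍_
_≍E_ {mon} = _≍ˡ_

-- Replace subst by its graph Subst k r bs t and induct on it.  Coherent
-- expressions have the same shape except at a ⊕ • versus • ⊕ a', and there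
-- the results can never be ≅-related, so the two derivations run in lockstep.
-- At a variable the substituted terms themselves are compared; under λ they
-- are shifted, and shifting reflects ≅.  For monomials the permutation sends
-- the image of the first element to the image of some element on the other
-- side; coherence makes the term case apply to these two, which identifies
-- them up to ≅ together with the chunks of b⃗ they consume, and the remaining
-- elements are handled by induction.
module Submission where

open import Defs
open import Data.Bool using (true; false; if_then_else_)
open import Data.Empty using (⊥-elim)
open import Data.Fin using (Fin; zero; suc; cast; punchIn)
open import Data.Fin.Properties using (cast-is-id; cast-involutive)
open import Data.Fin.Permutation
  using (Permutation; _⟨$⟩ʳ_; _⟨$⟩ˡ_; remove; insert; cast-id; _∘ₚ_; id; punchIn-permute)
open import Data.List using (List; []; _∷_; length; take; drop; _++_; lookup; removeAt)
open import Data.List.Properties using (++-assoc; take++drop≡id; ∷-injective; length-removeAt)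
open import Data.List.Membership.Propositional using (_∈_)
open import Data.List.Membership.Propositional.Properties using (∈-++⁺ˡ; ∈-++⁺ʳ; ∈-++⁻)
open import Data.List.Relation.Unary.Any using (here; there; index)
open import Data.List.Relation.Unary.Any.Properties using (lookup-index)
open import Data.Maybe using (just)
open import Data.Nat using (ℕ; zero; suc; _<_; _<ᵇ_; _≡ᵇ_)
open import Data.Nat.Properties using (<ᵇ-reflects-<; <⇒≤; suc-injective)
open import Data.Product using (Σ; ∃₂; _×_; _,_; proj₁; proj₂)
open import Data.Sum using (inj₁; inj₂)
open import Relation.Nullary.Reflects using (ofʸ; ofⁿ)
open import Relation.Binary.PropositionalEquality
  using (_≡_; refl; sym; trans; cong; cong₂) renaming (subst to transport)

-- Inductive counterpart of LookupPerm, the index-based form in which ≅ˡ is defined.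

data Perm {A B : Set} (R : A → B → Set) : List A → List B → Set where
  []  : Perm R [] []
  _∷_ : ∀ {a as b xs ys} → R a b → Perm R as (xs ++ ys) → Perm R (a ∷ as) (xs ++ b ∷ ys)

LookupPerm : {A B : Set} → (A → B → Set) → List A → List B → Set
LookupPerm R as bs =
  Σ (Permutation (length as) (length bs)) λ σ → ∀ i → R (lookup as i) (lookup bs (σ ⟨$⟩ʳ i))

module _ {B : Set} where

  lookup-removeAt : (b : B) (bs : List B) (j : Fin (suc (length bs)))
                    (m : Fin (length (removeAt (b ∷ bs) j))) →
                    lookup (removeAt (b ∷ bs) j) m
                      ≡ lookup (b ∷ bs) (punchIn j (cast (length-removeAt (b ∷ bs) j) m))
  lookup-removeAt b bs       zero    m       = cong (lookup bs) (sym (cast-is-id _ m))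
  lookup-removeAt b (c ∷ cs) (suc j) zero    = refl
  lookup-removeAt b (c ∷ cs) (suc j) (suc m) = lookup-removeAt c cs j m

  removeAt-split : (bs : List B) (j : Fin (length bs)) →
                   ∃₂ λ pre post → bs ≡ pre ++ lookup bs j ∷ post × removeAt bs j ≡ pre ++ post
  removeAt-split (b ∷ bs) zero = [] , bs , refl , refl
  removeAt-split (b ∷ bs) (suc j) with removeAt-split bs j
  ... | pre , post , bs≡ , removed≡ = b ∷ pre , post , cong (b ∷_) bs≡ , cong (b ∷_) removed≡

  removeAt-middle : (xs : List B) (b : B) (ys : List B) →
                    Σ (Fin (length (xs ++ b ∷ ys))) λ j →
                      lookup (xs ++ b ∷ ys) j ≡ b × removeAt (xs ++ b ∷ ys) j ≡ xs ++ ys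
  removeAt-middle []       b ys = zero , refl , refl
  removeAt-middle (x ∷ xs) b ys with removeAt-middle xs b ys
  ... | j , looked , removed = suc j , looked , cong (x ∷_) removed

module _ {A B : Set} {R : A → B → Set} where

  LookupPerm⇒Perm : ∀ as bs → LookupPerm R as bs → Perm R as bs
  LookupPerm⇒Perm []       []       (σ , _) = []
  LookupPerm⇒Perm []       (b ∷ bs) (σ , _) with σ ⟨$⟩ˡ zero
  ... | ()
  LookupPerm⇒Perm (a ∷ as) []       (σ , _) with σ ⟨$⟩ʳ zero
  ... | ()
  LookupPerm⇒Perm (a ∷ as) (b ∷ bs) (σ , related) with removeAt-split (b ∷ bs) (σ ⟨$⟩ʳ zero)
  ... | pre , post , split , removed =
    transport (Perm R (a ∷ as)) (sym split)
      (related zero ∷ transport (Perm R as) removed (LookupPerm⇒Perm as rest (σ′ , related′)))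
    where
    j    = σ ⟨$⟩ʳ zero
    rest = removeAt (b ∷ bs) j
    len  = length-removeAt (b ∷ bs) j
    σ′ : Permutation (length as) (length rest)
    σ′ = remove zero σ ∘ₚ cast-id (sym len)
    related′ : ∀ i → R (lookup as i) (lookup rest (σ′ ⟨$⟩ʳ i))
    related′ i = transport (R (lookup as i)) (sym same) (related (suc i))
      where
      same : lookup rest (σ′ ⟨$⟩ʳ i) ≡ lookup (b ∷ bs) (σ ⟨$⟩ʳ suc i)
      same = trans (lookup-removeAt b bs j _)
               (trans (cong (λ m → lookup (b ∷ bs) (punchIn j m))
                            (cast-involutive len (sym len) (remove zero σ ⟨$⟩ʳ i)))
                      (cong (lookup (b ∷ bs)) (sym (punchIn-permute σ zero i))))

  LookupPerm-insert : ∀ {a as} (bs : List B) (j : Fin (length bs)) → R a (lookup bs j) →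
                      LookupPerm R as (removeAt bs j) → LookupPerm R (a ∷ as) bs
  LookupPerm-insert {a} {as} (b ∷ bs) j r (σ , related) = σ′ , related′
    where
    σ′ : Permutation (suc (length as)) (suc (length bs))
    σ′ = insert zero j (σ ∘ₚ cast-id (length-removeAt (b ∷ bs) j))
    related′ : ∀ i → R (lookup (a ∷ as) i) (lookup (b ∷ bs) (σ′ ⟨$⟩ʳ i))
    related′ zero    = r
    related′ (suc i) = transport (R (lookup as i)) (lookup-removeAt b bs j (σ ⟨$⟩ʳ i)) (related i)

  Perm⇒LookupPerm : ∀ {as bs} → Perm R as bs → LookupPerm R as bs
  Perm⇒LookupPerm [] = id , λ ()
  Perm⇒LookupPerm {a ∷ as} (_∷_ {b = b} {xs} {ys} r p) with removeAt-middle xs b ys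
  ... | j , looked , removed =
    LookupPerm-insert (xs ++ b ∷ ys) j (transport (R a) (sym looked) r)
      (transport (LookupPerm R as) (sym removed) (Perm⇒LookupPerm p))

  Perm-++-middle : ∀ {xs ys zs} us vs → Perm R xs ys → Perm R zs (us ++ vs) →
                   Perm R (xs ++ zs) (us ++ ys ++ vs)
  Perm-++-middle us vs [] q = q
  Perm-++-middle {zs = zs} us vs (_∷_ {a} {as} {b} {ys₁} {ys₂} r p) q =
    transport (Perm R (a ∷ as ++ zs)) (sym outer)
      (r ∷ transport (Perm R (as ++ zs)) (sym inner) (Perm-++-middle us vs p q))
    where
    inner : (us ++ ys₁) ++ (ys₂ ++ vs) ≡ us ++ (ys₁ ++ ys₂) ++ vs
    inner = trans (++-assoc us ys₁ (ys₂ ++ vs)) (cong (us ++_) (sym (++-assoc ys₁ ys₂ vs)))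
    outer : us ++ (ys₁ ++ b ∷ ys₂) ++ vs ≡ (us ++ ys₁) ++ b ∷ (ys₂ ++ vs)
    outer = trans (cong (us ++_) (++-assoc ys₁ (b ∷ ys₂) vs)) (sym (++-assoc us ys₁ (b ∷ ys₂ ++ vs)))

≅ˡ⇒Perm : ∀ {as as'} → as ≅ˡ as' → Perm _≅_ as as'
≅ˡ⇒Perm {as} {as'} (perm≅ σ related) = LookupPerm⇒Perm as as' (σ , related)

Perm⇒≅ˡ : ∀ {as as'} → Perm _≅_ as as' → as ≅ˡ as'
Perm⇒≅ˡ p with Perm⇒LookupPerm p
... | σ , related = perm≅ σ related

mutual
  data Subst (k : ℕ) : Term → List Term → Term → Set where
    var-hit  : ∀ {i b} → (i ≡ᵇ k) ≡ true → Subst k (var i) (b ∷ []) b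
    var-miss : ∀ {i} → (i ≡ᵇ k) ≡ false → Subst k (var i) [] (var i)
    lam : ∀ {a bs u} → Subst (suc k) a (shifts 0 bs) u → Subst k (lam a) bs (lam u)
    app : ∀ {a ds bs cs u us} → Subst k a bs u → Substs k ds cs us →
          Subst k (app a ds) (bs ++ cs) (app u us)
    inl : ∀ {a bs u} → Subst k a bs u → Subst k (inl a) bs (inl u)
    inr : ∀ {a bs u} → Subst k a bs u → Subst k (inr a) bs (inr u)

  data Substs (k : ℕ) : List Term → List Term → List Term → Set where
    []  : Substs k [] [] []
    _∷_ : ∀ {a as bs cs u us} → Subst k a bs u → Substs k as cs us →
          Substs k (a ∷ as) (bs ++ cs) (u ∷ us)

mutual
  subst⇒Subst : ∀ k r bs {t} → subst k r bs ≡ just t → Subst k r bs t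
  subst⇒Subst k (var i) bs e with i ≡ᵇ k in hit
  subst⇒Subst k (var i) (b ∷ []) refl | true  = var-hit hit
  subst⇒Subst k (var i) []       refl | false = var-miss hit
  subst⇒Subst k (lam a) bs e with subst (suc k) a (shifts 0 bs) in ea
  subst⇒Subst k (lam a) bs refl | just _ = lam (subst⇒Subst (suc k) a (shifts 0 bs) ea)
  subst⇒Subst k (app a ds) bs e with subst k a (take (occ k a) bs) in ea
  ... | just u with substs k ds (drop (occ k a) bs) in eds
  ... | just us with e
  ... | refl = transport (λ bs′ → Subst k (app a ds) bs′ (app u us)) (take++drop≡id (occ k a) bs)
                 (app (subst⇒Subst k a _ ea) (substs⇒Substs k ds _ eds))
  subst⇒Subst k (inl a) bs e with subst k a bs in ea
  subst⇒Subst k (inl a) bs refl | just _ = inl (subst⇒Subst k a bs ea)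
  subst⇒Subst k (inr a) bs e with subst k a bs in ea
  subst⇒Subst k (inr a) bs refl | just _ = inr (subst⇒Subst k a bs ea)

  substs⇒Substs : ∀ k ds bs {us} → substs k ds bs ≡ just us → Substs k ds bs us
  substs⇒Substs k [] [] refl = []
  substs⇒Substs k (a ∷ as) bs e with subst k a (take (occ k a) bs) in ea
  ... | just u with substs k as (drop (occ k a) bs) in eas
  ... | just us with e
  ... | refl = transport (λ bs′ → Substs k (a ∷ as) bs′ (u ∷ us)) (take++drop≡id (occ k a) bs)
                 (subst⇒Subst k a _ ea ∷ substs⇒Substs k as _ eas)

Substs-split : ∀ {k ds bs us} → Substs k ds bs us → ∀ xs u ys → us ≡ xs ++ u ∷ ys →
  Σ (List Term) λ ds₁ → Σ Term λ d → Σ (List Term) λ ds₂ →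
  Σ (List Term) λ bs₁ → Σ (List Term) λ bsₘ → Σ (List Term) λ bs₂ →
  ds ≡ ds₁ ++ d ∷ ds₂ × bs ≡ bs₁ ++ bsₘ ++ bs₂ ×
  Substs k (ds₁ ++ ds₂) (bs₁ ++ bs₂) (xs ++ ys) × Subst k d bsₘ u
Substs-split (_∷_ {a} {as} {bs} {cs} s ss) [] u ys refl = [] , a , as , [] , bs , cs , refl , refl , ss , s
Substs-split {k} (_∷_ {a} {bs = bs} s ss) (x ∷ xs) u ys refl with Substs-split ss xs u ys refl
... | ds₁ , d , ds₂ , bs₁ , bsₘ , bs₂ , refl , refl , rest , sd =
  a ∷ ds₁ , d , ds₂ , bs ++ bs₁ , bsₘ , bs₂ , refl , sym (++-assoc bs bs₁ (bsₘ ++ bs₂)) ,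
  transport (λ bs′ → Substs k (a ∷ ds₁ ++ ds₂) bs′ (x ∷ xs ++ ys)) (sym (++-assoc bs bs₁ bs₂)) (s ∷ rest) ,
  sd

shiftIndex : ℕ → ℕ → ℕ
shiftIndex c i = if i <ᵇ c then i else suc i

shift-var : ∀ c i → shift c (var i) ≡ var (shiftIndex c i)
shift-var c i with i <ᵇ c
... | true  = refl
... | false = refl

shiftIndex-injective : ∀ c i j → shiftIndex c i ≡ shiftIndex c j → i ≡ j
shiftIndex-injective c i j e with i <ᵇ c | <ᵇ-reflects-< i c | j <ᵇ c | <ᵇ-reflects-< j c
... | true  | _        | true  | _        = e
... | false | _        | false | _        = suc-injective e
... | true  | ofʸ i<c  | false | ofⁿ j≮c  = ⊥-elim (j≮c (<⇒≤ (transport (_< c) e i<c)))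
... | false | ofⁿ i≮c  | true  | ofʸ j<c  = ⊥-elim (i≮c (<⇒≤ (transport (_< c) (sym e) j<c)))

≅-var : ∀ {i t} → var i ≅ t → t ≡ var i
≅-var var≅ = refl

≅-var˘ : ∀ {i t} → t ≅ var i → t ≡ var i
≅-var˘ var≅ = refl

shift≡var : ∀ c a {m} → shift c a ≡ var m → Σ ℕ λ i → a ≡ var i × shiftIndex c i ≡ m
shift≡var c (var i) e rewrite shift-var c i with e
... | refl = i , refl , refl
shift≡var c (lam _)   ()
shift≡var c (app _ _) ()
shift≡var c (inl _)   ()
shift≡var c (inr _)   ()

shifts-++ : ∀ c xs ys → shifts c (xs ++ ys) ≡ shifts c xs ++ shifts c ys
shifts-++ c []       ys = refl
shifts-++ c (x ∷ xs) ys = cong (shift c x ∷_) (shifts-++ c xs ys)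

shifts-split : ∀ c ds xs b ys → shifts c ds ≡ xs ++ b ∷ ys →
  Σ (List Term) λ ds₁ → Σ Term λ d → Σ (List Term) λ ds₂ →
  ds ≡ ds₁ ++ d ∷ ds₂ × shifts c ds₁ ≡ xs × shift c d ≡ b × shifts c ds₂ ≡ ys
shifts-split c (d ∷ ds) [] b ys e =
  [] , d , ds , refl , refl , proj₁ (∷-injective e) , proj₂ (∷-injective e)
shifts-split c (d ∷ ds) (x ∷ xs) b ys e with ∷-injective e
... | head≡ , tail≡ with shifts-split c ds xs b ys tail≡
... | ds₁ , d′ , ds₂ , refl , pre , mid , post = d ∷ ds₁ , d′ , ds₂ , refl , cong₂ _∷_ head≡ pre , mid , post

mutual
  shift-reflects-≅ : ∀ c a a' → shift c a ≅ shift c a' → a ≅ a'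
  shift-reflects-≅ c (var i) a' q
    with shift≡var c a' (≅-var (transport (_≅ shift c a') (shift-var c i) q))
  ... | j , refl , same rewrite shiftIndex-injective c j i same = var≅
  shift-reflects-≅ c a (var j) q
    with shift≡var c a (≅-var˘ (transport (shift c a ≅_) (shift-var c j) q))
  ... | i , refl , same rewrite shiftIndex-injective c i j same = var≅
  shift-reflects-≅ c (lam a) (lam a') (lam≅ q) = lam≅ (shift-reflects-≅ (suc c) a a' q)
  shift-reflects-≅ c (app a ds) (app a' ds') (app≅ q qs) =
    app≅ (shift-reflects-≅ c a a' q) (Perm⇒≅ˡ (shifts-reflects-Perm c ds ds' (≅ˡ⇒Perm qs)))
  shift-reflects-≅ c (inl a) (inl a') (inl≅ q) = inl≅ (shift-reflects-≅ c a a' q)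
  shift-reflects-≅ c (inr a) (inr a') (inr≅ q) = inr≅ (shift-reflects-≅ c a a' q)

  shifts-reflects-Perm : ∀ c ds ds' → Perm _≅_ (shifts c ds) (shifts c ds') → Perm _≅_ ds ds'
  shifts-reflects-Perm c ds ds' p = go ds p ds' refl
    where
    go : ∀ ds {ys} → Perm _≅_ (shifts c ds) ys → ∀ ds' → ys ≡ shifts c ds' → Perm _≅_ ds ds'
    go [] [] [] e = []
    go (a ∷ as) (_∷_ {b = b} {xs} {ys} q p) ds' e with shifts-split c ds' xs b ys (sym e)
    ... | ds₁ , a' , ds₂ , refl , refl , refl , refl =
      shift-reflects-≅ c a a' q ∷ go as p (ds₁ ++ ds₂) (sym (shifts-++ c ds₁ ds₂))

CrossCoherent : List Term → List Term → Set
CrossCoherent ds ds' = ∀ {d d'} → d ∈ ds → d' ∈ ds' → d ≍ d'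

≍ˡ⇒CrossCoherent : ∀ {ds ds'} → ds ≍ˡ ds' → CrossCoherent ds ds'
≍ˡ⇒CrossCoherent {ds} {ds'} (coh≍ coherent) {d} {d'} d∈ d'∈ =
  transport (_≍ d') (sym (lookup-index left))
    (transport (lookup (ds ++ ds') (index left) ≍_) (sym (lookup-index right))
      (coherent (index left) (index right)))
  where
  left  = ∈-++⁺ˡ {ys = ds'} d∈
  right = ∈-++⁺ʳ ds d'∈

CrossCoherent-remove : ∀ {d ds ds₁ d' ds₂} →
  CrossCoherent (d ∷ ds) (ds₁ ++ d' ∷ ds₂) → CrossCoherent ds (ds₁ ++ ds₂)
CrossCoherent-remove {ds₁ = ds₁} coherent d∈ d'∈ with ∈-++⁻ ds₁ d'∈
... | inj₁ d'∈₁ = coherent (there d∈) (∈-++⁺ˡ d'∈₁)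
... | inj₂ d'∈₂ = coherent (there d∈) (∈-++⁺ʳ ds₁ (there d'∈₂))

mutual
  Subst-reflects-≅ : ∀ {k r r' bs bs' t t'} → r ≍ r' → Subst k r bs t → Subst k r' bs' t' →
                     t ≅ t' → r ≅ r' × Perm _≅_ bs bs'
  Subst-reflects-≅ var≍ (var-hit _)  (var-hit _)  q = var≅ , _∷_ {xs = []} q []
  Subst-reflects-≅ var≍ (var-miss _) (var-miss _) q = var≅ , []
  Subst-reflects-≅ var≍ (var-hit hit)  (var-miss miss) q with trans (sym hit) miss
  ... | ()
  Subst-reflects-≅ var≍ (var-miss miss) (var-hit hit) q with trans (sym hit) miss
  ... | ()
  Subst-reflects-≅ (lam≍ h) (lam {bs = bs} s) (lam {bs = bs'} s') (lam≅ q)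
    with Subst-reflects-≅ h s s' q
  ... | a≅ , shifted = lam≅ a≅ , shifts-reflects-Perm 0 bs bs' shifted
  Subst-reflects-≅ (app≍ hc hds) (app s ss) (app s' ss') (app≅ q qs)
    with Subst-reflects-≅ hc s s' q | Substs-reflects-Perm (≍ˡ⇒CrossCoherent hds) ss ss' (≅ˡ⇒Perm qs)
  ... | c≅ , head | ds≅ , args = app≅ c≅ (Perm⇒≅ˡ ds≅) , Perm-++-middle [] _ head args
  Subst-reflects-≅ (inl≍ h) (inl s) (inl s') (inl≅ q) with Subst-reflects-≅ h s s' q
  ... | a≅ , p = inl≅ a≅ , p
  Subst-reflects-≅ (inr≍ h) (inr s) (inr s') (inr≅ q) with Subst-reflects-≅ h s s' q
  ... | a≅ , p = inr≅ a≅ , p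

  Substs-reflects-Perm : ∀ {k ds ds' bs bs' us us'} → CrossCoherent ds ds' →
                         Substs k ds bs us → Substs k ds' bs' us' →
                         Perm _≅_ us us' → Perm _≅_ ds ds' × Perm _≅_ bs bs'
  Substs-reflects-Perm coherent [] [] [] = [] , []
  Substs-reflects-Perm coherent (s ∷ ss) ss' (_∷_ {xs = xs} {ys} q p)
    with Substs-split ss' xs _ ys refl
  ... | ds₁ , d' , ds₂ , bs₁ , bsₘ , bs₂ , refl , refl , rest , s'
    with Subst-reflects-≅ (coherent (here refl) (∈-++⁺ʳ ds₁ (here refl))) s s' q
       | Substs-reflects-Perm (CrossCoherent-remove {ds₁ = ds₁} coherent) ss rest p
  ... | d≅ , mine | ds≅ , others = d≅ ∷ ds≅ , Perm-++-middle bs₁ bs₂ mine others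

corollary5p16 : (s : Sort) (x : ℕ) (r r' : Expr s) (bs bs' : List Term) →
                r ≍E r' → substE s x r bs ≅? substE s x r' bs' →
                (r ≅E r') × (bs ≅ˡ bs')
corollary5p16 tm x r r' bs bs' coherent related
  with subst x r bs in e | subst x r' bs' in e' | related
... | just t | just t' | just≅ t≅t'
  with Subst-reflects-≅ coherent (subst⇒Subst x r bs e) (subst⇒Subst x r' bs' e') t≅t'
... | r≅r' , bs≅bs' = r≅r' , Perm⇒≅ˡ bs≅bs'
corollary5p16 mon x r r' bs bs' coherent related
  with substs x r bs in e | substs x r' bs' in e' | related
... | just us | just us' | just≅ us≅us'
  with Substs-reflects-Perm (≍ˡ⇒CrossCoherent coherent)
         (substs⇒Substs x r bs e) (substs⇒Substs x r' bs' e') (≅ˡ⇒Perm us≅us')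
... | r≅r' , bs≅bs' = Perm⇒≅ˡ r≅r' , Perm⇒≅ˡ bs≅bs'
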